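{- For any integers $k \geq 2$, $n\ge 0$, $\beta \geq 0$, and $0 \leq \alpha \leq k-1$, $$C^k_{n,(\alpha,\beta)} = \begin{cases} \frac{\beta+1}{kn+\beta+1} \binom{kn+\beta+1}{n} & \text{ if } n>0,\\ 1 & \text{ if } n=0 \text{ and } \alpha \leq \beta,\\ 0 & \text{ if } n=0 \text{ and } \alpha > \beta. \end{cases}$$
   Context: For an integer $k\ge 2$ and integers $\alpha,\beta, n\ge 0$, let $C^k_{n,(\alpha,\beta)}$ be the number of integer lattice paths from $(0,\alpha)$ to $(kn+\beta-\alpha,\beta)$ using steps $U=(1,1)$ and $D=(1,1-k)$ that stay weakly above the line $y=0$ (such paths have exactly $n$ steps $D$; the empty path counts when $n=0$, $\alpha=\beta$; the count is $0$ when $kn+\beta-\alpha<0$). -}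

module Defs where

open import Data.Nat using (ℕ; zero; suc; _+_; _*_; _∸_; _≤_; _<_)
open import Data.Nat.Properties using (_≟_; _≤?_)
open import Data.List using (List; []; _∷_; map; _++_; length; filter)
open import Relation.Nullary using (Dec; yes; no; ¬_)
open import Relation.Binary.PropositionalEquality using (_≡_; refl)

-- Steps of a lattice path: U = (1,1), D = (1,1-k).
data Step : Set where
  U D : Step

words : ℕ → List (List Step)
words zero    = [] ∷ []
words (suc L) = map (U ∷_) (words L) ++ map (D ∷_) (words L)

-- Valid k h b w : the path with step word w, starting at height h,
-- never goes below y = 0 and ends at height b.
-- A D step from height h goes to h + 1 - k, which must be ≥ 0, i.e. k ≤ h + 1.
data Valid (k : ℕ) : ℕ → ℕ → List Step → Set where
  end  : ∀ {b} → Valid k b b []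
  up   : ∀ {h b w} → Valid k (suc h) b w → Valid k h b (U ∷ w)
  down : ∀ {h b w} → k ≤ suc h → Valid k (suc h ∸ k) b w → Valid k h b (D ∷ w)

valid? : ∀ k h b w → Dec (Valid k h b w)
valid? k h b [] with h ≟ b
... | yes refl = yes end
... | no h≢b = no λ { end → h≢b refl }
valid? k h b (U ∷ w) with valid? k (suc h) b w
... | yes v = yes (up v)
... | no ¬v = no λ { (up v) → ¬v v }
valid? k h b (D ∷ w) with k ≤? suc h
... | no ¬le = no λ { (down le _) → ¬le le }
... | yes le with valid? k (suc h ∸ k) b w
...   | yes v = yes (down le v)
...   | no ¬v = no λ { (down _ v) → ¬v v }

-- C^k_{n,(α,β)} : number of lattice paths from (0,α) to (kn+β-α, β) with steps U, D
-- staying weakly above y = 0; it is 0 when kn+β-α < 0.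
Cpaths : (k n α β : ℕ) → ℕ
Cpaths k n α β with α ≤? k * n + β
... | yes _ = length (filter (valid? k α β) (words (k * n + β ∸ α)))
... | no  _ = 0

module Submission where

-- A path ending at height b ends either with U from b − 1 or with D from b + k − 1.
-- Since α ≤ k − 1, the first α steps are forced to be U, so only paths from height 0
-- matter; for those, with L = kn + β,
--   #paths(0 → β, L steps) = C(L, n) − (k − 1) C(L, n − 1),
-- by induction on L via the last step and Pascal's rule, using for β = 0 (where the
-- last step must be D) the identity (k − 1) C(L, n) = C(L, n + 1) for L = kn + k − 1.
-- The absorption identity n C(L + 1, n) = (L + 1) C(L, n − 1) turns this difference
-- into (β + 1)/(L + 1) · C(L + 1, n).

open import Defs
open import Data.Nat using (ℕ; zero; suc; _+_; _*_; _≤_; _<_; _∸_; s≤s; >-nonZero)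
open import Data.Nat.Properties
open import Data.Nat.Combinatorics using (_C_; nCk+nC[k+1]≡[n+1]C[k+1]; nC1≡n)
open import Data.Nat.Tactic.RingSolver using (solve-∀)
open import Algebra.Properties.CommutativeSemigroup +-commutativeSemigroup using (interchange)
open import Data.List using (List; []; _∷_; map; _++_; length; filter)
open import Data.List.Properties using (length-++; filter-++)
open import Data.Product using (_×_; _,_)
open import Data.Empty using (⊥-elim)
open import Relation.Nullary using (Dec; yes; no; ¬_)
open import Relation.Unary using (Decidable)
open import Relation.Binary.PropositionalEquality
  using (_≡_; refl; sym; trans; cong; cong₂; subst; module ≡-Reasoning)

open ≡-Reasoning

when : {P : Set} → Dec P → ℕ → ℕ
when (yes _) x = x
when (no _)  _ = 0

when-⇔ : {P Q : Set} (p : Dec P) (q : Dec Q) → (P → Q) → (Q → P) → ∀ x → when p x ≡ when q x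
when-⇔ (yes _) (yes _) _   _   _ = refl
when-⇔ (yes p) (no ¬q) p⇒q _   _ = ⊥-elim (¬q (p⇒q p))
when-⇔ (no ¬p) (yes q) _   q⇒p _ = ⊥-elim (¬p (q⇒p q))
when-⇔ (no _)  (no _)  _   _   _ = refl

when-no : {P : Set} (p : Dec P) → ¬ P → ∀ x → when p x ≡ 0
when-no (yes p) ¬p _ = ⊥-elim (¬p p)
when-no (no _)  _  _ = refl

when-0 : {P : Set} (p : Dec P) → when p 0 ≡ 0
when-0 (yes _) = refl
when-0 (no _)  = refl

when-+ : {P : Set} (p : Dec P) → ∀ x y → when p (x + y) ≡ when p x + when p y
when-+ (yes _) _ _ = refl
when-+ (no _)  _ _ = refl

module _ {A : Set} {P : A → Set} (P? : Decidable P) where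

  length-filter-[x] : ∀ x → length (filter P? (x ∷ [])) ≡ when (P? x) 1
  length-filter-[x] x with P? x
  ... | yes _ = refl
  ... | no _  = refl

  length-filter-map : {B : Set} {Q : B → Set} (Q? : Decidable Q) (f : B → A) →
                      (∀ x → P (f x) → Q x) → (∀ x → Q x → P (f x)) →
                      ∀ xs → length (filter P? (map f xs)) ≡ length (filter Q? xs)
  length-filter-map Q? f to from []       = refl
  length-filter-map Q? f to from (x ∷ xs) with P? (f x) | Q? x
  ... | yes _  | yes _  = cong suc (length-filter-map Q? f to from xs)
  ... | yes pf | no ¬q  = ⊥-elim (¬q (to x pf))
  ... | no ¬pf | yes q  = ⊥-elim (¬pf (from x q))
  ... | no _   | no _   = length-filter-map Q? f to from xs

  length-filter-map-none : {B : Set} (f : B → A) → (∀ x → ¬ P (f x)) →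
                           ∀ xs → length (filter P? (map f xs)) ≡ 0
  length-filter-map-none f ¬P []       = refl
  length-filter-map-none f ¬P (x ∷ xs) with P? (f x)
  ... | yes pf = ⊥-elim (¬P x pf)
  ... | no _   = length-filter-map-none f ¬P xs

paths : (k h b L : ℕ) → ℕ
paths k h b zero    = when (h ≟ b) 1
paths k h b (suc L) = paths k (suc h) b L + when (k ≤? suc h) (paths k (suc h ∸ k) b L)

count-valid≡paths : ∀ k h b L → length (filter (valid? k h b) (words L)) ≡ paths k h b L
count-valid≡paths k h b zero =
  trans (length-filter-[x] (valid? k h b) [])
        (when-⇔ (valid? k h b []) (h ≟ b) (λ { end → refl }) (λ { refl → end }) 1)
count-valid≡paths k h b (suc L) = begin
  length (filter V? (map (U ∷_) ws ++ map (D ∷_) ws))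
    ≡⟨ cong length (filter-++ V? (map (U ∷_) ws) (map (D ∷_) ws)) ⟩
  length (filter V? (map (U ∷_) ws) ++ filter V? (map (D ∷_) ws))
    ≡⟨ length-++ (filter V? (map (U ∷_) ws)) ⟩
  length (filter V? (map (U ∷_) ws)) + length (filter V? (map (D ∷_) ws))
    ≡⟨ cong₂ _+_ starting-up starting-down ⟩
  paths k (suc h) b L + when (k ≤? suc h) (paths k (suc h ∸ k) b L) ∎
  where
    V? : ∀ w → Dec (Valid k h b w)
    V? = valid? k h b
    ws : List (List Step)
    ws = words L

    starting-up : length (filter V? (map (U ∷_) ws)) ≡ paths k (suc h) b L
    starting-up = trans (length-filter-map V? (valid? k (suc h) b) (U ∷_) (λ { _ (up v) → v }) (λ _ → up) ws)
                        (count-valid≡paths k (suc h) b L)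

    starting-down : length (filter V? (map (D ∷_) ws)) ≡ when (k ≤? suc h) (paths k (suc h ∸ k) b L)
    starting-down with k ≤? suc h
    ... | yes k≤h+1 = trans (length-filter-map V? (valid? k (suc h ∸ k) b) (D ∷_)
                                 (λ { _ (down _ v) → v }) (λ _ → down k≤h+1) ws)
                            (count-valid≡paths k (suc h ∸ k) b L)
    ... | no k≰h+1  = length-filter-map-none V? (D ∷_) (λ { _ (down k≤h+1 _) → k≰h+1 k≤h+1 }) ws

Cpaths≡paths : ∀ k n α β → α ≤ k * n + β → Cpaths k n α β ≡ paths k α β (k * n + β ∸ α)
Cpaths≡paths k n α β α≤L with α ≤? k * n + β
... | yes _   = count-valid≡paths k α β (k * n + β ∸ α)
... | no α≰L  = ⊥-elim (α≰L α≤L)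

Cpaths≡0 : ∀ k n α β → ¬ α ≤ k * n + β → Cpaths k n α β ≡ 0
Cpaths≡0 k n α β α≰L with α ≤? k * n + β
... | yes α≤L = ⊥-elim (α≰L α≤L)
... | no _    = refl

paths-forced-up : ∀ k h b L → suc h < k → paths k h b (suc L) ≡ paths k (suc h) b L
paths-forced-up k h b L h+1<k =
  trans (cong (paths k (suc h) b L +_) (when-no (k ≤? suc h) (<⇒≱ h+1<k) _)) (+-identityʳ _)

paths-initial-ups : ∀ k α b L → α < k → paths k 0 b (α + L) ≡ paths k α b L
paths-initial-ups k zero    b L _     = refl
paths-initial-ups k (suc α) b L α+1<k = begin
  paths k 0 b (suc α + L)  ≡⟨ cong (paths k 0 b) (sym (+-suc α L)) ⟩
  paths k 0 b (α + suc L)  ≡⟨ paths-initial-ups k α b (suc L) (<⇒≤ α+1<k) ⟩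
  paths k α b (suc L)      ≡⟨ paths-forced-up k α b L α+1<k ⟩
  paths k (suc α) b L      ∎

paths-unreachable : ∀ k h b L → h + L < b → paths k h b L ≡ 0
paths-unreachable k h b zero    h+0<b = when-no (h ≟ b) (<⇒≢ (subst (_< b) (+-identityʳ h) h+0<b)) 1
paths-unreachable k h b (suc L) h+L+1<b = cong₂ _+_ by-up by-down
  where
    h+1+L<b : suc h + L < b
    h+1+L<b = subst (_< b) (+-suc h L) h+L+1<b
    by-up : paths k (suc h) b L ≡ 0
    by-up = paths-unreachable k (suc h) b L h+1+L<b
    by-down : when (k ≤? suc h) (paths k (suc h ∸ k) b L) ≡ 0
    by-down = trans (cong (when (k ≤? suc h)) (paths-unreachable k (suc h ∸ k) b L
                      (≤-<-trans (+-monoˡ-≤ L (m∸n≤m (suc h) k)) h+1+L<b)))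
                    (when-0 (k ≤? suc h))

paths⁻ : (k h b L : ℕ) → ℕ
paths⁻ k h zero    L = 0
paths⁻ k h (suc b) L = paths k h b L

paths⁻-first-step : ∀ k h b L →
  paths⁻ k h b (suc L) ≡ paths⁻ k (suc h) b L + when (k ≤? suc h) (paths⁻ k (suc h ∸ k) b L)
paths⁻-first-step k h zero    L = sym (when-0 (k ≤? suc h))
paths⁻-first-step k h (suc b) L = refl

paths-last-step : ∀ s h b L → paths (suc s) h b (suc L) ≡ paths⁻ (suc s) h b L + paths (suc s) h (b + s) L
paths-last-step s h b zero = cong₂ _+_ (ending-up b) ending-down
  where
    ending-up : ∀ b → when (suc h ≟ b) 1 ≡ paths⁻ (suc s) h b 0
    ending-up zero    = when-no (suc h ≟ 0) (λ ()) 1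
    ending-up (suc b) = when-⇔ (suc h ≟ suc b) (h ≟ b) suc-injective (cong suc) 1

    ending-down : when (suc s ≤? suc h) (when (h ∸ s ≟ b) 1) ≡ when (h ≟ b + s) 1
    ending-down with suc s ≤? suc h
    ... | yes (s≤s s≤h) = when-⇔ (h ∸ s ≟ b) (h ≟ b + s)
                            (λ h-s≡b → trans (sym (m∸n+n≡m s≤h)) (cong (_+ s) h-s≡b))
                            (λ { refl → m+n∸n≡m b s }) 1
    ... | no s+1≰h+1    = sym (when-no (h ≟ b + s) (λ { refl → s+1≰h+1 (s≤s (m≤n+m s b)) }) 1)
paths-last-step s h b (suc L) = begin
  paths k (suc h) b (suc L) + when c (paths k h′ b (suc L))
    ≡⟨ cong₂ (λ x y → x + when c y) (paths-last-step s (suc h) b L) (paths-last-step s h′ b L) ⟩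
  (afterU⁻ + afterU) + when c (afterD⁻ + afterD)
    ≡⟨ cong ((afterU⁻ + afterU) +_) (when-+ c afterD⁻ afterD) ⟩
  (afterU⁻ + afterU) + (when c afterD⁻ + when c afterD)
    ≡⟨ interchange afterU⁻ afterU (when c afterD⁻) (when c afterD) ⟩
  (afterU⁻ + when c afterD⁻) + (afterU + when c afterD)
    ≡⟨ cong (_+ paths k h (b + s) (suc L)) (sym (paths⁻-first-step k h b L)) ⟩
  paths⁻ k h b (suc L) + paths k h (b + s) (suc L) ∎
  where
    k h′ afterU⁻ afterU afterD⁻ afterD : ℕ
    k = suc s
    h′ = suc h ∸ k
    c : Dec (k ≤ suc h)
    c = k ≤? suc h
    afterU⁻ = paths⁻ k (suc h) b L
    afterU = paths k (suc h) (b + s) L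
    afterD⁻ = paths⁻ k h′ b L
    afterD = paths k h′ (b + s) L

_C⁻_ : ℕ → ℕ → ℕ
n C⁻ zero    = 0
n C⁻ (suc k) = n C k

[n+1]Ck≡nCk+nC⁻k : ∀ n k → suc n C k ≡ n C k + n C⁻ k
[n+1]Ck≡nCk+nC⁻k n zero    = refl
[n+1]Ck≡nCk+nC⁻k n (suc k) = trans (sym (nCk+nC[k+1]≡[n+1]C[k+1] n k)) (+-comm (n C k) (n C suc k))

[k+1]*[n+1]C[k+1]≡[n+1]*nCk : ∀ n k → suc k * (suc n C suc k) ≡ suc n * (n C k)
[k+1]*[n+1]C[k+1]≡[n+1]*nCk zero    zero    = refl
[k+1]*[n+1]C[k+1]≡[n+1]*nCk zero    (suc k) = *-zeroʳ (suc (suc k))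
[k+1]*[n+1]C[k+1]≡[n+1]*nCk (suc n) zero    =
  trans (+-identityʳ _) (trans (nC1≡n (suc (suc n))) (sym (*-identityʳ (suc (suc n)))))
[k+1]*[n+1]C[k+1]≡[n+1]*nCk (suc n) (suc k) = begin
  suc (suc k) * (suc (suc n) C suc (suc k))
    ≡⟨ cong (suc (suc k) *_) (sym (nCk+nC[k+1]≡[n+1]C[k+1] (suc n) (suc k))) ⟩
  suc (suc k) * (N C suc k + N C suc (suc k))
    ≡⟨ split k (N C suc k) (N C suc (suc k)) ⟩
  N C suc k + (suc k * (N C suc k) + suc (suc k) * (N C suc (suc k)))
    ≡⟨ cong (λ x → N C suc k + x) (cong₂ _+_ ([k+1]*[n+1]C[k+1]≡[n+1]*nCk n k)
                                           ([k+1]*[n+1]C[k+1]≡[n+1]*nCk n (suc k))) ⟩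
  N C suc k + (N * (n C k) + N * (n C suc k))
    ≡⟨ cong (λ x → N C suc k + x) (sym (*-distribˡ-+ N (n C k) (n C suc k))) ⟩
  N C suc k + N * (n C k + n C suc k)
    ≡⟨ cong (λ x → N C suc k + N * x) (nCk+nC[k+1]≡[n+1]C[k+1] n k) ⟩
  suc N * (N C suc k) ∎
  where
    N : ℕ
    N = suc n
    split : ∀ k x y → suc (suc k) * (x + y) ≡ x + (suc k * x + suc (suc k) * y)
    split = solve-∀

k*[n+1]Ck≡[n+1]*nC⁻k : ∀ n k → k * (suc n C k) ≡ suc n * (n C⁻ k)
k*[n+1]Ck≡[n+1]*nC⁻k n zero    = sym (*-zeroʳ (suc n))
k*[n+1]Ck≡[n+1]*nC⁻k n (suc k) = [k+1]*[n+1]C[k+1]≡[n+1]*nCk n k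

[k+1]*nC[k+1]+k*nCk≡n*nCk : ∀ n k → suc k * (n C suc k) + k * (n C k) ≡ n * (n C k)
[k+1]*nC[k+1]+k*nCk≡n*nCk zero    zero    = refl
[k+1]*nC[k+1]+k*nCk≡n*nCk zero    (suc k) = cong₂ _+_ (*-zeroʳ (suc (suc k))) (*-zeroʳ (suc k))
[k+1]*nC[k+1]+k*nCk≡n*nCk (suc n) k = begin
  suc k * (suc n C suc k) + k * (suc n C k)
    ≡⟨ cong₂ _+_ ([k+1]*[n+1]C[k+1]≡[n+1]*nCk n k) (k*[n+1]Ck≡[n+1]*nC⁻k n k) ⟩
  suc n * (n C k) + suc n * (n C⁻ k)
    ≡⟨ sym (*-distribˡ-+ (suc n) (n C k) (n C⁻ k)) ⟩
  suc n * (n C k + n C⁻ k)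
    ≡⟨ cong (suc n *_) (sym ([n+1]Ck≡nCk+nC⁻k n k)) ⟩
  suc n * (suc n C k) ∎

module Ballot (s : ℕ) where

  k : ℕ
  k = suc s

  s*LCn≡LC[n+1] : ∀ {L} n → k * n + s ≡ L → s * (L C n) ≡ L C suc n
  s*LCn≡LC[n+1] {L} n refl = sym (*-cancelˡ-≡ _ _ (suc n) (+-cancelʳ-≡ (n * (L C n)) _ _ (begin
    suc n * (L C suc n) + n * (L C n) ≡⟨ [k+1]*nC[k+1]+k*nCk≡n*nCk L n ⟩
    L * (L C n)                       ≡⟨ regroup s n (L C n) ⟩
    suc n * (s * (L C n)) + n * (L C n) ∎)))
    where
      regroup : ∀ s n x → (suc s * n + s) * x ≡ suc n * (s * x) + n * x
      regroup = solve-∀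

  difference-last-step : ∀ L n β →
    paths k 0 β L + s * (L C n) ≡ L C suc n →
    paths k 0 (suc β + s) L + s * (L C⁻ n) ≡ L C n →
    paths k 0 (suc β) (suc L) + s * (suc L C n) ≡ suc L C suc n
  difference-last-step L n β viaU viaD = begin
    paths k 0 (suc β) (suc L) + s * (suc L C n)
      ≡⟨ cong₂ _+_ (paths-last-step s 0 (suc β) L) (cong (s *_) ([n+1]Ck≡nCk+nC⁻k L n)) ⟩
    (endU + endD) + s * (L C n + L C⁻ n)
      ≡⟨ cong ((endU + endD) +_) (*-distribˡ-+ s (L C n) (L C⁻ n)) ⟩
    (endU + endD) + (s * (L C n) + s * (L C⁻ n))
      ≡⟨ interchange endU endD (s * (L C n)) (s * (L C⁻ n)) ⟩
    (endU + s * (L C n)) + (endD + s * (L C⁻ n))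
      ≡⟨ cong₂ _+_ viaU viaD ⟩
    L C suc n + L C n
      ≡⟨ +-comm (L C suc n) (L C n) ⟩
    L C n + L C suc n
      ≡⟨ nCk+nC[k+1]≡[n+1]C[k+1] L n ⟩
    suc L C suc n ∎
    where
      endU endD : ℕ
      endU = paths k 0 β L
      endD = paths k 0 (suc β + s) L

  difference-last-step-at-0 : ∀ L n → k * n + s ≡ L →
    paths k 0 s L + s * (L C⁻ n) ≡ L C n →
    paths k 0 0 (suc L) + s * (suc L C n) ≡ suc L C suc n
  difference-last-step-at-0 L n e viaD = begin
    paths k 0 0 (suc L) + s * (suc L C n)
      ≡⟨ cong₂ _+_ (paths-last-step s 0 0 L) (cong (s *_) ([n+1]Ck≡nCk+nC⁻k L n)) ⟩
    endD + s * (L C n + L C⁻ n)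
      ≡⟨ regroup endD s (L C n) (L C⁻ n) ⟩
    (endD + s * (L C⁻ n)) + s * (L C n)
      ≡⟨ cong₂ _+_ viaD (s*LCn≡LC[n+1] n e) ⟩
    L C n + L C suc n
      ≡⟨ nCk+nC[k+1]≡[n+1]C[k+1] L n ⟩
    suc L C suc n ∎
    where
      endD : ℕ
      endD = paths k 0 s L
      regroup : ∀ p s x y → p + s * (x + y) ≡ (p + s * y) + s * x
      regroup = solve-∀

  ballot-difference : ∀ L n β → k * n + β ≡ L → paths k 0 β L + s * (L C⁻ n) ≡ L C n
  ballot-difference zero    zero    zero    _ = cong suc (*-zeroʳ s)
  ballot-difference zero    zero    (suc β) e = ⊥-elim (0≢1+n (sym (m+n≡0⇒n≡0 (k * 0) e)))
  ballot-difference zero    (suc n) β       ()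
  ballot-difference (suc L) zero    zero    e = ⊥-elim (0≢1+n (trans (sym (cong (_+ 0) (*-zeroʳ s))) e))
  ballot-difference (suc L) zero    (suc β) e = begin
    paths k 0 (suc β) (suc L) + s * 0
      ≡⟨ cong (_+ s * 0) (paths-last-step s 0 (suc β) L) ⟩
    (paths k 0 β L + paths k 0 (suc β + s) L) + s * 0
      ≡⟨ cong (λ x → (paths k 0 β L + x) + s * 0) (paths-unreachable k 0 (suc β + s) L L<β+1+s) ⟩
    (paths k 0 β L + 0) + s * 0
      ≡⟨ cong (_+ s * 0) (+-identityʳ (paths k 0 β L)) ⟩
    paths k 0 β L + s * 0
      ≡⟨ ballot-difference L zero β e′ ⟩
    1 ∎
    where
      e′ : k * 0 + β ≡ L
      e′ = suc-injective (trans (sym (+-suc (k * 0) β)) e)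
      L<β+1+s : L < suc β + s
      L<β+1+s = s≤s (≤-trans (≤-reflexive (trans (sym e′) (cong (_+ β) (*-zeroʳ k)))) (m≤m+n β s))
  ballot-difference (suc L) (suc n) (suc β) e =
    difference-last-step L n β (ballot-difference L (suc n) β e′) (ballot-difference L n (suc β + s) e″)
    where
      e′ : k * suc n + β ≡ L
      e′ = suc-injective (trans (sym (+-suc (k * suc n) β)) e)
      e″ : k * n + (suc β + s) ≡ L
      e″ = trans (shift s n β) e′
        where
          shift : ∀ s n β → suc s * n + (suc β + s) ≡ suc s * suc n + β
          shift = solve-∀
  ballot-difference (suc L) (suc n) zero    e =
    difference-last-step-at-0 L n e′ (ballot-difference L n s e′)
    where
      e′ : k * n + s ≡ L
      e′ = suc-injective (trans (shift s n) e)
        where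
          shift : ∀ s n → suc (suc s * n + s) ≡ suc s * suc n + 0
          shift = solve-∀

  ballot-from-difference : ∀ n β {R} → R + s * ((k * n + β) C⁻ n) ≡ (k * n + β) C n →
                           suc (k * n + β) * R ≡ suc β * (suc (k * n + β) C n)
  ballot-from-difference n β {R} difference = +-cancelʳ-≡ (k * n * c) _ _ (begin
    suc L * R + k * n * c                  ≡⟨ split-k (suc L * R) s n c ⟩
    suc L * R + s * (n * c) + n * c        ≡⟨ cong (λ x → suc L * R + s * x + x) (k*[n+1]Ck≡[n+1]*nC⁻k L n) ⟩
    suc L * R + s * (suc L * c⁻) + suc L * c⁻ ≡⟨ cong (_+ suc L * c⁻) (factor (suc L) R s c⁻) ⟩
    suc L * (R + s * c⁻) + suc L * c⁻      ≡⟨ cong (λ x → suc L * x + suc L * c⁻) difference ⟩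
    suc L * (L C n) + suc L * c⁻           ≡⟨ sym (*-distribˡ-+ (suc L) (L C n) c⁻) ⟩
    suc L * (L C n + c⁻)                   ≡⟨ cong (suc L *_) (sym ([n+1]Ck≡nCk+nC⁻k L n)) ⟩
    suc L * c                              ≡⟨ unfold-L s n β c ⟩
    suc β * c + k * n * c                  ∎)
    where
      L c c⁻ : ℕ
      L = k * n + β
      c = suc L C n
      c⁻ = L C⁻ n
      split-k : ∀ a s n x → a + suc s * n * x ≡ a + s * (n * x) + n * x
      split-k = solve-∀
      factor : ∀ l r s d → l * r + s * (l * d) ≡ l * (r + s * d)
      factor = solve-∀
      unfold-L : ∀ s n β x → suc (suc s * n + β) * x ≡ suc β * x + suc s * n * x
      unfold-L = solve-∀

  ballot : ∀ n β → (k * n + β + 1) * paths k 0 β (k * n + β) ≡ (β + 1) * ((k * n + β + 1) C n)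
  ballot n β = begin
    (L + 1) * paths k 0 β L  ≡⟨ cong (_* paths k 0 β L) (+-comm L 1) ⟩
    suc L * paths k 0 β L    ≡⟨ ballot-from-difference n β (ballot-difference L n β refl) ⟩
    suc β * (suc L C n)      ≡⟨ cong₂ (λ b l → b * (l C n)) (+-comm 1 β) (+-comm 1 L) ⟩
    (β + 1) * ((L + 1) C n)  ∎
    where
      L : ℕ
      L = k * n + β

  Cpaths≡paths-from-0 : ∀ n α β → α ≤ s → α ≤ k * n + β → Cpaths k n α β ≡ paths k 0 β (k * n + β)
  Cpaths≡paths-from-0 n α β α≤s α≤L = begin
    Cpaths k n α β              ≡⟨ Cpaths≡paths k n α β α≤L ⟩
    paths k α β (L ∸ α)         ≡⟨ sym (paths-initial-ups k α β (L ∸ α) (s≤s α≤s)) ⟩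
    paths k 0 β (α + (L ∸ α))   ≡⟨ cong (paths k 0 β) (m+[n∸m]≡n α≤L) ⟩
    paths k 0 β L               ∎
    where
      L : ℕ
      L = k * n + β

corollary2p4 : (k n α β : ℕ) → 2 ≤ k → α ≤ k ∸ 1 →
    ((0 < n → (k * n + β + 1) * Cpaths k n α β ≡ (β + 1) * ((k * n + β + 1) C n))
    × (n ≡ 0 → α ≤ β → Cpaths k n α β ≡ 1)
    × (n ≡ 0 → β < α → Cpaths k n α β ≡ 0))
corollary2p4 zero    _ _ _ () _
corollary2p4 (suc s) n α β _  α≤s = positive , reachable , unreachable
  where
    open Ballot s

    positive : 0 < n → (k * n + β + 1) * Cpaths k n α β ≡ (β + 1) * ((k * n + β + 1) C n)
    positive 0<n = trans (cong ((k * n + β + 1) *_) (Cpaths≡paths-from-0 n α β α≤s α≤L)) (ballot n β)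
      where
        α≤L : α ≤ k * n + β
        α≤L = ≤-trans α≤s (≤-trans (n≤1+n s) (≤-trans (m≤m*n k n {{>-nonZero 0<n}}) (m≤m+n (k * n) β)))

    reachable : n ≡ 0 → α ≤ β → Cpaths k n α β ≡ 1
    reachable refl α≤β = begin
      Cpaths k 0 α β                        ≡⟨ Cpaths≡paths-from-0 0 α β α≤s (≤-trans α≤β (m≤n+m β (k * 0))) ⟩
      paths k 0 β (k * 0 + β)               ≡⟨ sym (trans (cong (P +_) (*-zeroʳ s)) (+-identityʳ P)) ⟩
      paths k 0 β (k * 0 + β) + s * 0       ≡⟨ ballot-difference (k * 0 + β) 0 β refl ⟩
      1                                     ∎
      where
        P : ℕ
        P = paths k 0 β (k * 0 + β)

    unreachable : n ≡ 0 → β < α → Cpaths k n α β ≡ 0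
    unreachable refl β<α = Cpaths≡0 k 0 α β (λ α≤k*0+β → <⇒≱ β<α (subst (α ≤_) k*0+β≡β α≤k*0+β))
      where
        k*0+β≡β : k * 0 + β ≡ β
        k*0+β≡β = cong (_+ β) (*-zeroʳ k)
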